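{- Let $n\ge3$. (1) For any $\mathbf{p}\in\mathbb{Q}^{n!}$ there exists $\widehat{\mathbf{p}}\in\mathbb{N}_0^{n!}$ such that $Q_{\widehat{\mathbf{p}}}\mathbf{w}$ lies in the same face as $Q_{\mathbf{p}}\mathbf{w}$ for all $\mathbf{w}\in\overline{W}$. (2) For any $\mathbf{p}\in\mathbb{Q}^{n!}$ there exists $\widetilde{\mathbf{p}}\in\mathbb{Q}^{n!}$ with $\widetilde{p}_\ell\ge 0$ for all $\ell$, $\sum_{\ell=1}^{n!}\widetilde{p}_\ell=1$, and such that $Q_{\widetilde{\mathbf{p}}}\mathbf{w}$ lies in the same face as $Q_{\mathbf{p}}\mathbf{w}$ for all $\mathbf{w}\in\overline{W}$.
   Context: Work over $\mathbb{Q}$; $\mathbb{N}_0$ denotes the nonnegative integers. Index the permutations of $S_n$ as $\sigma_1,\dots,\sigma_{n!}$ and let $R_\ell$ be the $n\times n$ permutation matrix with $R_\ell(i,j)=1$ if $\sigma_\ell(j)=i$ and $0$ otherwise. For $\mathbf{p}\in\mathbb{Q}^{n!}$ put $Q_{\mathbf{p}}=\sum_{\ell=1}^{n!}p_\ell R_\ell$. Let $\overline{W}=\{\mathbf{x}\in\mathbb{Q}^n:\ x_1\ge x_2\ge\cdots\ge x_n,\ x_1+\cdots+x_n=0\}$. Two vectors $\mathbf{x},\mathbf{y}\in\mathbb{Q}^n$ lie in the same face (of the braid arrangement) if for all $i,j\in[n]$, $x_i>x_j\iff y_i>y_j$ (equivalently, they induce the same ordered set partition of $[n]$ into blocks of tied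 coordinates ordered by decreasing value). -}

module Defs where

open import Data.Nat using (ℕ; zero; suc; _!)
open import Data.Fin using (Fin; zero; suc; _≟_)
import Data.Fin as Fin
open import Data.Integer using (+_)
open import Data.Rational using (ℚ; 0ℚ; 1ℚ; _+_; _*_; _≤_; _<_; _/_)
open import Data.Product using (Σ; _×_; _,_)
open import Relation.Nullary using (yes; no)
open import Relation.Binary.PropositionalEquality using (_≡_)
open import Function.Definitions using (Injective)

Σℚ : (m : ℕ) → (Fin m → ℚ) → ℚ
Σℚ zero    f = 0ℚ
Σℚ (suc m) f = f zero + Σℚ m (λ i → f (suc i))

Vecℚ : ℕ → Set
Vecℚ m = Fin m → ℚ

Matℚ : ℕ → Set
Matℚ m = Fin m → Fin m → ℚ

-- A permutation of [n] is an injective (hence bijective) map Fin n → Fin n.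
IsPerm : (n : ℕ) → (Fin n → Fin n) → Set
IsPerm n π = Injective _≡_ _≡_ π

-- An indexing σ_1,…,σ_{n!} of S_n: every σ_ℓ is a permutation, and every
-- permutation equals (pointwise) σ_ℓ for exactly one ℓ.
IsEnumeration : (n : ℕ) → (Fin (n !) → Fin n → Fin n) → Set
IsEnumeration n σ =
  ((ℓ : Fin (n !)) → IsPerm n (σ ℓ)) ×
  ((π : Fin n → Fin n) → IsPerm n π →
     Σ (Fin (n !)) λ ℓ → ((i : Fin n) → σ ℓ i ≡ π i) ×
       ((ℓ′ : Fin (n !)) → ((i : Fin n) → σ ℓ′ i ≡ π i) → ℓ′ ≡ ℓ))

R : (n : ℕ) → (Fin (n !) → Fin n → Fin n) → Fin (n !) → Matℚ n
R n σ ℓ i j with σ ℓ j ≟ i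
... | yes _ = 1ℚ
... | no  _ = 0ℚ

Q : (n : ℕ) → (Fin (n !) → Fin n → Fin n) → Vecℚ (n !) → Matℚ n
Q n σ p i j = Σℚ (n !) (λ ℓ → p ℓ * R n σ ℓ i j)

_·_ : {m : ℕ} → Matℚ m → Vecℚ m → Vecℚ m
(A · x) i = Σℚ _ (λ j → A i j * x j)

ℕ→ℚ : ℕ → ℚ
ℕ→ℚ k = + k / 1

InWbar : (n : ℕ) → Vecℚ n → Set
InWbar n w = ((i j : Fin n) → i Fin.≤ j → w j ≤ w i) × (Σℚ n w ≡ 0ℚ)

-- Same face of the braid arrangement: x_i > x_j ⇔ y_i > y_j for all i, j.
SameFace : (n : ℕ) → Vecℚ n → Vecℚ n → Set
SameFace n x y = (i j : Fin n) → (x j < x i → y j < y i) × (y j < y i → x j < x i)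

module Submission where

-- Every permutation occurs exactly once among the σ ℓ, so left composition with a
-- transposition (i i′) permutes the indices ℓ. Hence the entry Q_𝟙(i, j), the number of
-- ℓ with σ ℓ j = i, does not depend on i, and Q_𝟙 w is a constant vector. Replacing p by
-- p + c𝟙 therefore translates Q_p w by a constant vector, which keeps its face, and makes
-- all weights positive once c > Σ ∣p ℓ∣. Multiplying positive weights by a positive
-- rational also keeps the face: a common denominator yields p̂, and 1/Σ yields p̃.

open import Defs
open import Algebra.Bundles using (CommutativeRing)
open import Data.Empty using (⊥-elim)
open import Data.Fin using (Fin; zero; suc)
import Data.Fin as Fin
open import Data.Fin.Permutation using (Permutation′; permutation; flip; transpose; _⟨$⟩ʳ_; _⟨$⟩ˡ_; inverseˡ; inverseʳ)
import Data.Fin.Permutation.Components as PC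
open import Data.Integer using (-[1+_]) renaming (+_ to pos)
import Data.Integer as ℤ
import Data.Integer.Properties as ℤ
open import Data.Nat using (ℕ; zero; suc; _≤_; _!)
import Data.Nat as ℕ
import Data.Nat.Properties as ℕ
open import Data.Product using (Σ; _×_; _,_; proj₁; proj₂)
open import Data.Rational using (ℚ; 0ℚ; 1ℚ; mkℚ; _+_; _*_; -_; _/_; _<_; ∣_∣; 1/_; fromℚᵘ; toℚᵘ; positive; nonNegative)
import Data.Rational as ℚ
open import Data.Rational.Properties
open import Data.Rational.Unnormalised as ℚᵘ using (mkℚᵘ; *≡*)
import Data.Rational.Unnormalised.Properties as ℚᵘ
open import Data.Sum using (inj₁; inj₂)
open import Function using (_∘_)
open import Function.Bundles using (Injection)
open import Function.Properties.Inverse using (↔⇒↣)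
open import Relation.Binary.PropositionalEquality using (_≡_; refl; sym; trans; cong; cong₂; subst₂; module ≡-Reasoning)
open import Relation.Nullary using (¬_; yes; no)
open import Relation.Nullary.Decidable using (dec-true)

open import Algebra.Properties.Semiring.Sum (CommutativeRing.semiring +-*-commutativeRing)
  using (sum; sum-syntax; sum-cong-≗; ∑-distrib-+; ∑-comm; *-distribˡ-sum; *-distribʳ-sum; sum-permute)

Σℚ≗sum : ∀ m (f : Vecℚ m) → Σℚ m f ≡ sum f
Σℚ≗sum zero    f = refl
Σℚ≗sum (suc m) f = cong (f zero +_) (Σℚ≗sum m (f ∘ suc))

sum-nonNeg : ∀ {m} (f : Vecℚ m) → (∀ ℓ → 0ℚ ℚ.≤ f ℓ) → 0ℚ ℚ.≤ sum f
sum-nonNeg {zero}  f f≥0 = ≤-refl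
sum-nonNeg {suc m} f f≥0 = +-mono-≤ (f≥0 zero) (sum-nonNeg (f ∘ suc) (f≥0 ∘ suc))

≤-sum : ∀ {m} (f : Vecℚ m) → (∀ ℓ → 0ℚ ℚ.≤ f ℓ) → ∀ ℓ → f ℓ ℚ.≤ sum f
≤-sum f f≥0 zero = begin
  f zero          ≡⟨ +-identityʳ (f zero) ⟨
  f zero + 0ℚ     ≤⟨ +-monoʳ-≤ (f zero) (sum-nonNeg (f ∘ suc) (f≥0 ∘ suc)) ⟩
  sum f           ∎
  where open ≤-Reasoning
≤-sum f f≥0 (suc ℓ) = begin
  f (suc ℓ)       ≡⟨ +-identityˡ (f (suc ℓ)) ⟨
  0ℚ + f (suc ℓ)  ≤⟨ +-mono-≤ (f≥0 zero) (≤-sum (f ∘ suc) (f≥0 ∘ suc) ℓ) ⟩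
  sum f           ∎
  where open ≤-Reasoning

sum-positive : ∀ {m} (f : Vecℚ m) → (∀ ℓ → 0ℚ < f ℓ) → Fin m → 0ℚ < sum f
sum-positive f f>0 ℓ = <-≤-trans (f>0 ℓ) (≤-sum f (<⇒≤ ∘ f>0) ℓ)

0≤p+∣p∣ : ∀ p → 0ℚ ℚ.≤ p + ∣ p ∣
0≤p+∣p∣ p with ∣p∣≡p∨∣p∣≡-p p
... | inj₁ ∣p∣≡p  = +-mono-≤ (∣p∣≡p⇒0≤p ∣p∣≡p) (0≤∣p∣ p)
... | inj₂ ∣p∣≡-p = ≤-reflexive (sym (trans (cong (p +_) ∣p∣≡-p) (+-inverseʳ p)))

offset : ∀ {m} → Vecℚ m → ℚ
offset p = 1ℚ + sum (λ ℓ → ∣ p ℓ ∣)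

_⁺ : ∀ {m} → Vecℚ m → Vecℚ m
(p ⁺) ℓ = p ℓ + offset p

⁺-positive : ∀ {m} (p : Vecℚ m) ℓ → 0ℚ < (p ⁺) ℓ
⁺-positive p ℓ = begin-strict
  0ℚ                                  <⟨ positive⁻¹ 1ℚ ⟩
  1ℚ                                  ≡⟨ +-identityˡ 1ℚ ⟨
  0ℚ + 1ℚ                             ≤⟨ +-monoˡ-≤ 1ℚ (0≤p+∣p∣ (p ℓ)) ⟩
  (p ℓ + ∣ p ℓ ∣) + 1ℚ                ≡⟨ +-assoc (p ℓ) (∣ p ℓ ∣) 1ℚ ⟩
  p ℓ + (∣ p ℓ ∣ + 1ℚ)                ≡⟨ cong (p ℓ +_) (+-comm (∣ p ℓ ∣) 1ℚ) ⟩
  p ℓ + (1ℚ + ∣ p ℓ ∣)                ≤⟨ +-monoʳ-≤ (p ℓ) (+-monoʳ-≤ 1ℚ (≤-sum (λ k → ∣ p k ∣) (λ k → 0≤∣p∣ (p k)) ℓ)) ⟩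
  (p ⁺) ℓ                             ∎
  where open ≤-Reasoning

fromℚᵘ-homo-* : ∀ u v → fromℚᵘ (u ℚᵘ.* v) ≡ fromℚᵘ u * fromℚᵘ v
fromℚᵘ-homo-* u v = begin
  fromℚᵘ (u ℚᵘ.* v)                                ≡⟨ fromℚᵘ-cong (ℚᵘ.*-cong (toℚᵘ-fromℚᵘ u) (toℚᵘ-fromℚᵘ v)) ⟨
  fromℚᵘ (toℚᵘ (fromℚᵘ u) ℚᵘ.* toℚᵘ (fromℚᵘ v))    ≡⟨ fromℚᵘ-cong (toℚᵘ-homo-* (fromℚᵘ u) (fromℚᵘ v)) ⟨
  fromℚᵘ (toℚᵘ (fromℚᵘ u * fromℚᵘ v))              ≡⟨ fromℚᵘ-toℚᵘ _ ⟩
  fromℚᵘ u * fromℚᵘ v                              ∎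
  where open ≡-Reasoning

ℕ→ℚ-* : ∀ a b → ℕ→ℚ (a ℕ.* b) ≡ ℕ→ℚ a * ℕ→ℚ b
ℕ→ℚ-* a b = trans (cong (λ z → fromℚᵘ (mkℚᵘ z 0)) (ℤ.pos-* a b)) (fromℚᵘ-homo-* (mkℚᵘ (pos a) 0) (mkℚᵘ (pos b) 0))

ℕ→ℚ-positive : ∀ d → 0ℚ < ℕ→ℚ (suc d)
ℕ→ℚ-positive d = positive⁻¹ (ℕ→ℚ (suc d)) {{normalize-pos (suc d) 1}}

ℕ→ℚ-*-/ : ∀ a d → ℕ→ℚ (suc d) * (pos a / suc d) ≡ ℕ→ℚ a
ℕ→ℚ-*-/ a d = trans (sym (fromℚᵘ-homo-* (mkℚᵘ (pos (suc d)) 0) (mkℚᵘ (pos a) d)))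
                     (fromℚᵘ-cong {mkℚᵘ (pos (suc d)) 0 ℚᵘ.* mkℚᵘ (pos a) d} {mkℚᵘ (pos a) 0} (*≡* cross))
  where
  open ≡-Reasoning
  cross : (pos (suc d) ℤ.* pos a) ℤ.* pos 1 ≡ pos a ℤ.* pos (suc (d ℕ.+ 0))
  cross = begin
    (pos (suc d) ℤ.* pos a) ℤ.* pos 1   ≡⟨ ℤ.*-identityʳ _ ⟩
    pos (suc d) ℤ.* pos a               ≡⟨ ℤ.*-comm (pos (suc d)) (pos a) ⟩
    pos a ℤ.* pos (suc d)               ≡⟨ cong (λ k → pos a ℤ.* pos (suc k)) (ℕ.+-identityʳ d) ⟨
    pos a ℤ.* pos (suc (d ℕ.+ 0))       ∎

clearDenominator : ∀ p → 0ℚ ℚ.≤ p → Σ ℕ λ d → Σ ℕ λ a → ℕ→ℚ (suc d) * p ≡ ℕ→ℚ a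
clearDenominator p@(mkℚ (pos a) d _) _ = d , a , trans (cong (ℕ→ℚ (suc d) *_) (sym (↥p/↧p≡p p))) (ℕ→ℚ-*-/ a d)
clearDenominator (mkℚ -[1+ a ] d _) 0≤p = ⊥-elim (negative (nonNegative 0≤p))
  where
  negative : ¬ ℤ.NonNegative -[1+ a ]
  negative ()

clearDenominators : ∀ {m} (p : Vecℚ m) → (∀ ℓ → 0ℚ ℚ.≤ p ℓ) →
                    Σ ℕ λ d → Σ (Fin m → ℕ) λ p̂ → ∀ ℓ → ℕ→ℚ (p̂ ℓ) ≡ ℕ→ℚ (suc d) * p ℓ
clearDenominators {zero}  p p≥0 = 0 , (λ ()) , (λ ())
clearDenominators {suc m} p p≥0
  with clearDenominator (p zero) (p≥0 zero) | clearDenominators (p ∘ suc) (p≥0 ∘ suc)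
... | e , a , e*p₀≡a | d , p̂ , p̂≡d*p = d ℕ.+ e ℕ.* suc d , p̂′ , p̂′≡D*p
  where
  open ≡-Reasoning
  -- D reduces to suc (d + e * suc d), the denominator returned above.
  D : ℕ
  D = suc e ℕ.* suc d
  p̂′ : Fin (suc m) → ℕ
  p̂′ zero    = a ℕ.* suc d
  p̂′ (suc ℓ) = suc e ℕ.* p̂ ℓ
  p̂′≡D*p : ∀ ℓ → ℕ→ℚ (p̂′ ℓ) ≡ ℕ→ℚ D * p ℓ
  p̂′≡D*p zero = begin
    ℕ→ℚ (a ℕ.* suc d)                              ≡⟨ ℕ→ℚ-* a (suc d) ⟩
    ℕ→ℚ a * ℕ→ℚ (suc d)                            ≡⟨ cong (_* ℕ→ℚ (suc d)) e*p₀≡a ⟨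
    (ℕ→ℚ (suc e) * p zero) * ℕ→ℚ (suc d)           ≡⟨ *-assoc (ℕ→ℚ (suc e)) (p zero) (ℕ→ℚ (suc d)) ⟩
    ℕ→ℚ (suc e) * (p zero * ℕ→ℚ (suc d))           ≡⟨ cong (ℕ→ℚ (suc e) *_) (*-comm (p zero) (ℕ→ℚ (suc d))) ⟩
    ℕ→ℚ (suc e) * (ℕ→ℚ (suc d) * p zero)           ≡⟨ *-assoc (ℕ→ℚ (suc e)) (ℕ→ℚ (suc d)) (p zero) ⟨
    (ℕ→ℚ (suc e) * ℕ→ℚ (suc d)) * p zero           ≡⟨ cong (_* p zero) (ℕ→ℚ-* (suc e) (suc d)) ⟨
    ℕ→ℚ D * p zero                                 ∎
  p̂′≡D*p (suc ℓ) = begin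
    ℕ→ℚ (suc e ℕ.* p̂ ℓ)                            ≡⟨ ℕ→ℚ-* (suc e) (p̂ ℓ) ⟩
    ℕ→ℚ (suc e) * ℕ→ℚ (p̂ ℓ)                        ≡⟨ cong (ℕ→ℚ (suc e) *_) (p̂≡d*p ℓ) ⟩
    ℕ→ℚ (suc e) * (ℕ→ℚ (suc d) * p (suc ℓ))        ≡⟨ *-assoc (ℕ→ℚ (suc e)) (ℕ→ℚ (suc d)) (p (suc ℓ)) ⟨
    (ℕ→ℚ (suc e) * ℕ→ℚ (suc d)) * p (suc ℓ)        ≡⟨ cong (_* p (suc ℓ)) (ℕ→ℚ-* (suc e) (suc d)) ⟨
    ℕ→ℚ D * p (suc ℓ)                              ∎

sameFace-trans : ∀ {n} {x y z : Vecℚ n} → SameFace n x y → SameFace n y z → SameFace n x z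
sameFace-trans x~y y~z i j =
  (λ x< → proj₁ (y~z i j) (proj₁ (x~y i j) x<)) ,
  (λ z< → proj₂ (x~y i j) (proj₂ (y~z i j) z<))

sameFace-image : ∀ {n} (f : ℚ → ℚ) → (∀ {a b} → a < b → f a < f b) → (∀ {a b} → f a < f b → a < b) →
                 {x y : Vecℚ n} → (∀ i → y i ≡ f (x i)) → SameFace n y x
sameFace-image f f-mono f-cancel y≡fx i j =
  (λ y< → f-cancel (subst₂ _<_ (y≡fx j) (y≡fx i) y<)) ,
  (λ x< → subst₂ _<_ (sym (y≡fx j)) (sym (y≡fx i)) (f-mono x<))

sameFace-scale : ∀ {n} (a : ℚ) → 0ℚ < a → {x y : Vecℚ n} → (∀ i → y i ≡ a * x i) → SameFace n y x
sameFace-scale a a>0 = sameFace-image (a *_) (*-monoʳ-<-pos a) (*-cancelˡ-<-nonNeg a)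
  where
  instance
    a-pos : ℚ.Positive a
    a-pos = positive a>0
    a-nonNeg : ℚ.NonNegative a
    a-nonNeg = pos⇒nonNeg a

sameFace-translate : ∀ {n} (b : Vecℚ n) → (∀ i j → b i ≡ b j) →
                     {x y : Vecℚ n} → (∀ i → y i ≡ x i + b i) → SameFace n y x
sameFace-translate b b-const {x} y≡x+b i j =
  sameFace-image (_+ b i) (+-monoˡ-< (b i)) cancel (λ k → trans (y≡x+b k) (cong (x k +_) (b-const k i))) i j
  where
  open ≡-Reasoning
  +-b : ∀ c → (c + b i) + - b i ≡ c
  +-b c = begin
    (c + b i) + - b i  ≡⟨ +-assoc c (b i) (- b i) ⟩
    c + (b i + - b i)  ≡⟨ cong (c +_) (+-inverseʳ (b i)) ⟩
    c + 0ℚ             ≡⟨ +-identityʳ c ⟩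
    c                  ∎
  cancel : ∀ {c d} → c + b i < d + b i → c < d
  cancel {c} {d} c+b<d+b = subst₂ _<_ (+-b c) (+-b d) (+-monoˡ-< (- b i) c+b<d+b)

module _ {n : ℕ} (σ : Fin (n !) → Fin n → Fin n) where

  Q·≡∑ : ∀ p w i → (Q n σ p · w) i ≡ ∑[ ℓ < n ! ] (p ℓ * (R n σ ℓ · w) i)
  Q·≡∑ p w i = begin
    Σℚ n (λ j → Σℚ (n !) (λ ℓ → p ℓ * R n σ ℓ i j) * w j)
      ≡⟨ trans (Σℚ≗sum n _) (sum-cong-≗ (λ j → cong (_* w j) (Σℚ≗sum (n !) _))) ⟩
    ∑[ j < n ] (∑[ ℓ < n ! ] (p ℓ * R n σ ℓ i j) * w j)
      ≡⟨ sum-cong-≗ (λ j → *-distribʳ-sum (w j) (λ ℓ → p ℓ * R n σ ℓ i j)) ⟩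
    ∑[ j < n ] (∑[ ℓ < n ! ] (p ℓ * R n σ ℓ i j * w j))
      ≡⟨ ∑-comm (λ j ℓ → p ℓ * R n σ ℓ i j * w j) ⟩
    ∑[ ℓ < n ! ] (∑[ j < n ] (p ℓ * R n σ ℓ i j * w j))
      ≡⟨ sum-cong-≗ (λ ℓ → trans (sum-cong-≗ (λ j → *-assoc (p ℓ) _ (w j))) (sym (*-distribˡ-sum (p ℓ) (λ j → R n σ ℓ i j * w j)))) ⟩
    ∑[ ℓ < n ! ] (p ℓ * ∑[ j < n ] (R n σ ℓ i j * w j))
      ≡⟨ sum-cong-≗ (λ ℓ → cong (p ℓ *_) (sym (Σℚ≗sum n _))) ⟩
    ∑[ ℓ < n ! ] (p ℓ * (R n σ ℓ · w) i)
      ∎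
    where open ≡-Reasoning

  Q·-+ : ∀ p q w i → (Q n σ (λ ℓ → p ℓ + q ℓ) · w) i ≡ (Q n σ p · w) i + (Q n σ q · w) i
  Q·-+ p q w i = begin
    (Q n σ (λ ℓ → p ℓ + q ℓ) · w) i                                ≡⟨ Q·≡∑ (λ ℓ → p ℓ + q ℓ) w i ⟩
    ∑[ ℓ < n ! ] ((p ℓ + q ℓ) * (R n σ ℓ · w) i)                     ≡⟨ sum-cong-≗ (λ ℓ → *-distribʳ-+ _ (p ℓ) (q ℓ)) ⟩
    ∑[ ℓ < n ! ] (p ℓ * (R n σ ℓ · w) i + q ℓ * (R n σ ℓ · w) i)     ≡⟨ ∑-distrib-+ (λ ℓ → p ℓ * (R n σ ℓ · w) i) (λ ℓ → q ℓ * (R n σ ℓ · w) i) ⟩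
    ∑[ ℓ < n ! ] (p ℓ * (R n σ ℓ · w) i) + ∑[ ℓ < n ! ] (q ℓ * (R n σ ℓ · w) i)
                                                                    ≡⟨ cong₂ _+_ (Q·≡∑ p w i) (Q·≡∑ q w i) ⟨
    (Q n σ p · w) i + (Q n σ q · w) i                              ∎
    where open ≡-Reasoning

  Q·-scale : ∀ {p r} a → (∀ ℓ → r ℓ ≡ a * p ℓ) → ∀ w i → (Q n σ r · w) i ≡ a * (Q n σ p · w) i
  Q·-scale {p} {r} a r≡ap w i = begin
    (Q n σ r · w) i                               ≡⟨ Q·≡∑ r w i ⟩
    ∑[ ℓ < n ! ] (r ℓ * (R n σ ℓ · w) i)             ≡⟨ sum-cong-≗ (λ ℓ → trans (cong (_* _) (r≡ap ℓ)) (*-assoc a (p ℓ) _)) ⟩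
    ∑[ ℓ < n ! ] (a * (p ℓ * (R n σ ℓ · w) i))       ≡⟨ *-distribˡ-sum a (λ ℓ → p ℓ * (R n σ ℓ · w) i) ⟨
    a * ∑[ ℓ < n ! ] (p ℓ * (R n σ ℓ · w) i)         ≡⟨ cong (a *_) (Q·≡∑ p w i) ⟨
    a * (Q n σ p · w) i                           ∎
    where open ≡-Reasoning

  R-cong : ∀ {ℓ ℓ′ i i′ j j′} → (σ ℓ j ≡ i → σ ℓ′ j′ ≡ i′) → (σ ℓ′ j′ ≡ i′ → σ ℓ j ≡ i) →
           R n σ ℓ i j ≡ R n σ ℓ′ i′ j′
  R-cong {ℓ} {ℓ′} {i} {i′} {j} {j′} to from with σ ℓ j Fin.≟ i | σ ℓ′ j′ Fin.≟ i′
  ... | yes _  | yes _   = refl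
  ... | no _   | no _    = refl
  ... | yes e  | no ¬e′  = ⊥-elim (¬e′ (to e))
  ... | no ¬e  | yes e′  = ⊥-elim (¬e (from e′))

transpose-matchˡ : ∀ {n} (i j : Fin n) → PC.transpose i j i ≡ j
transpose-matchˡ i j rewrite dec-true (i Fin.≟ i) refl = refl

module Enumeration {n : ℕ} {σ : Fin (n !) → Fin n → Fin n} (E : IsEnumeration n σ) where

  index : (π : Fin n → Fin n) → IsPerm n π → Fin (n !)
  index π π-perm = proj₁ (proj₂ E π π-perm)

  σ-index : ∀ π (π-perm : IsPerm n π) i → σ (index π π-perm) i ≡ π i
  σ-index π π-perm = proj₁ (proj₂ (proj₂ E π π-perm))

  index-unique : ∀ π (π-perm : IsPerm n π) ℓ → (∀ i → σ ℓ i ≡ π i) → ℓ ≡ index π π-perm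
  index-unique π π-perm = proj₂ (proj₂ (proj₂ E π π-perm))

  composeˡ : Permutation′ n → Fin (n !) → Fin (n !)
  composeˡ τ ℓ = index (λ i → τ ⟨$⟩ʳ σ ℓ i) (proj₁ E ℓ ∘ Injection.injective (↔⇒↣ τ))

  σ-composeˡ : ∀ τ ℓ i → σ (composeˡ τ ℓ) i ≡ τ ⟨$⟩ʳ σ ℓ i
  σ-composeˡ τ ℓ = σ-index _ _

  composeˡ-inverse : ∀ τ ρ → (∀ x → τ ⟨$⟩ʳ (ρ ⟨$⟩ʳ x) ≡ x) → ∀ ℓ → composeˡ τ (composeˡ ρ ℓ) ≡ ℓ
  composeˡ-inverse τ ρ τρ≗id ℓ = sym (index-unique _ _ ℓ (λ i → sym (begin
    τ ⟨$⟩ʳ σ (composeˡ ρ ℓ) i    ≡⟨ cong (τ ⟨$⟩ʳ_) (σ-composeˡ ρ ℓ i) ⟩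
    τ ⟨$⟩ʳ (ρ ⟨$⟩ʳ σ ℓ i)        ≡⟨ τρ≗id (σ ℓ i) ⟩
    σ ℓ i                        ∎)))
    where open ≡-Reasoning

  leftMultiplication : Permutation′ n → Permutation′ (n !)
  leftMultiplication τ = permutation (composeˡ τ) (composeˡ (flip τ))
    (composeˡ-inverse τ (flip τ) (λ _ → inverseʳ τ))
    (composeˡ-inverse (flip τ) τ (λ _ → inverseˡ τ))

  ∑R-invariant : ∀ τ i j → ∑[ ℓ < n ! ] R n σ ℓ i j ≡ ∑[ ℓ < n ! ] R n σ ℓ (τ ⟨$⟩ˡ i) j
  ∑R-invariant τ i j = trans (sum-permute (λ ℓ → R n σ ℓ i j) (leftMultiplication τ))
                             (sum-cong-≗ (λ ℓ → R-cong σ (to ℓ) (from ℓ)))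
    where
    to : ∀ ℓ → σ (composeˡ τ ℓ) j ≡ i → σ ℓ j ≡ τ ⟨$⟩ˡ i
    to ℓ e = trans (sym (inverseˡ τ)) (cong (τ ⟨$⟩ˡ_) (trans (sym (σ-composeˡ τ ℓ j)) e))
    from : ∀ ℓ → σ ℓ j ≡ τ ⟨$⟩ˡ i → σ (composeˡ τ ℓ) j ≡ i
    from ℓ e = trans (σ-composeˡ τ ℓ j) (trans (cong (τ ⟨$⟩ʳ_) e) (inverseʳ τ))

  𝟙 : Vecℚ (n !)
  𝟙 _ = 1ℚ

  Q𝟙-rowIndependent : ∀ i i′ j → Q n σ 𝟙 i j ≡ Q n σ 𝟙 i′ j
  Q𝟙-rowIndependent i i′ j = begin
    Q n σ 𝟙 i j                       ≡⟨ Σℚ≗sum (n !) _ ⟩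
    ∑[ ℓ < n ! ] (1ℚ * R n σ ℓ i j)   ≡⟨ sum-cong-≗ (λ ℓ → *-identityˡ (R n σ ℓ i j)) ⟩
    ∑[ ℓ < n ! ] R n σ ℓ i j          ≡⟨ ∑R-invariant (transpose i′ i) i j ⟩
    ∑[ ℓ < n ! ] R n σ ℓ (PC.transpose i i′ i) j
                                      ≡⟨ cong (λ k → ∑[ ℓ < n ! ] R n σ ℓ k j) (transpose-matchˡ i i′) ⟩
    ∑[ ℓ < n ! ] R n σ ℓ i′ j         ≡⟨ sum-cong-≗ (λ ℓ → *-identityˡ (R n σ ℓ i′ j)) ⟨
    ∑[ ℓ < n ! ] (1ℚ * R n σ ℓ i′ j)  ≡⟨ Σℚ≗sum (n !) _ ⟨
    Q n σ 𝟙 i′ j                      ∎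
    where open ≡-Reasoning

  Q𝟙·-constant : ∀ w i i′ → (Q n σ 𝟙 · w) i ≡ (Q n σ 𝟙 · w) i′
  Q𝟙·-constant w i i′ = begin
    (Q n σ 𝟙 · w) i                   ≡⟨ Σℚ≗sum n _ ⟩
    ∑[ j < n ] (Q n σ 𝟙 i j * w j)    ≡⟨ sum-cong-≗ (λ j → cong (_* w j) (Q𝟙-rowIndependent i i′ j)) ⟩
    ∑[ j < n ] (Q n σ 𝟙 i′ j * w j)   ≡⟨ Σℚ≗sum n _ ⟨
    (Q n σ 𝟙 · w) i′                  ∎
    where open ≡-Reasoning

  ⁺-sameFace : ∀ p w → SameFace n (Q n σ (p ⁺) · w) (Q n σ p · w)
  ⁺-sameFace p w = sameFace-translate (λ i → offset p * (Q n σ 𝟙 · w) i)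
    (λ i i′ → cong (offset p *_) (Q𝟙·-constant w i i′))
    (λ i → trans (Q·-+ σ p (λ _ → offset p) w i)
                 (cong ((Q n σ p · w) i +_) (Q·-scale σ (offset p) (λ _ → sym (*-identityʳ (offset p))) w i)))

  multiple-sameFace : ∀ p {r} a → 0ℚ < a → (∀ ℓ → r ℓ ≡ a * (p ⁺) ℓ) →
                      ∀ w → SameFace n (Q n σ r · w) (Q n σ p · w)
  multiple-sameFace p a a>0 r≡ap⁺ w =
    sameFace-trans (sameFace-scale a a>0 (Q·-scale σ a r≡ap⁺ w)) (⁺-sameFace p w)

  integralRepresentative : ∀ p → Σ (Fin (n !) → ℕ) λ p̂ →
                           ∀ w → SameFace n (Q n σ (λ ℓ → ℕ→ℚ (p̂ ℓ)) · w) (Q n σ p · w)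
  integralRepresentative p with clearDenominators (p ⁺) (<⇒≤ ∘ ⁺-positive p)
  ... | d , p̂ , p̂≡D*p⁺ = p̂ , multiple-sameFace p (ℕ→ℚ (suc d)) (ℕ→ℚ-positive d) p̂≡D*p⁺

  stochasticRepresentative : ∀ p → Σ (Vecℚ (n !)) λ p̃ →
                             (∀ ℓ → 0ℚ ℚ.≤ p̃ ℓ) × (Σℚ (n !) p̃ ≡ 1ℚ) ×
                             (∀ w → SameFace n (Q n σ p̃ · w) (Q n σ p · w))
  stochasticRepresentative p = p̃ , p̃≥0 , Σp̃≡1 , multiple-sameFace p (1/ S) 1/S>0 (λ _ → refl)
    where
    open ≡-Reasoning
    S : ℚ
    S = ∑[ ℓ < n ! ] (p ⁺) ℓ
    instance
      S-pos : ℚ.Positive S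
      S-pos = positive (sum-positive (p ⁺) (⁺-positive p) (index (λ i → i) (λ e → e)))
      S-nonZero : ℚ.NonZero S
      S-nonZero = pos⇒nonZero S
    1/S>0 : 0ℚ < 1/ S
    1/S>0 = positive⁻¹ (1/ S) {{1/pos⇒pos S}}
    p̃ : Vecℚ (n !)
    p̃ ℓ = 1/ S * (p ⁺) ℓ
    p̃≥0 : ∀ ℓ → 0ℚ ℚ.≤ p̃ ℓ
    p̃≥0 ℓ = <⇒≤ (positive⁻¹ (p̃ ℓ) {{pos*pos⇒pos (1/ S) {{1/pos⇒pos S}} ((p ⁺) ℓ) {{positive (⁺-positive p ℓ)}}}})
    Σp̃≡1 : Σℚ (n !) p̃ ≡ 1ℚ
    Σp̃≡1 = begin
      Σℚ (n !) p̃          ≡⟨ Σℚ≗sum (n !) p̃ ⟩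
      ∑[ ℓ < n ! ] p̃ ℓ    ≡⟨ *-distribˡ-sum (1/ S) (p ⁺) ⟨
      1/ S * S            ≡⟨ *-inverseˡ S ⟩
      1ℚ                  ∎

proposition3p8 : (n : ℕ) → 3 ≤ n →
    (σ : Fin (n !) → Fin n → Fin n) → IsEnumeration n σ →
    ((p : Vecℚ (n !)) →
      Σ (Fin (n !) → ℕ) λ p̂ →
        (w : Vecℚ n) → InWbar n w →
          SameFace n (Q n σ (λ ℓ → ℕ→ℚ (p̂ ℓ)) · w) (Q n σ p · w))
    × ((p : Vecℚ (n !)) →
      Σ (Vecℚ (n !)) λ p̃ →
        ((ℓ : Fin (n !)) → 0ℚ ℚ.≤ p̃ ℓ) × (Σℚ (n !) p̃ ≡ 1ℚ) ×
        ((w : Vecℚ n) → InWbar n w →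
          SameFace n (Q n σ p̃ · w) (Q n σ p · w)))
proposition3p8 n _ σ E =
    (λ p → let p̂ , faces = integralRepresentative p in p̂ , λ w _ → faces w)
  , (λ p → let p̃ , p̃≥0 , Σp̃≡1 , faces = stochasticRepresentative p in p̃ , p̃≥0 , Σp̃≡1 , λ w _ → faces w)
  where open Enumeration E
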